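{- Let $m = p_1^{e_1}\cdots p_r^{e_r}$, $R=\{1,\dots,r\}$, $I\subseteq R$, and let $C_I$ be the connected component of the sequential power graph of $\mathbb{Z}/m\mathbb{Z}$ containing $d_I$. Then an element $v \in C_I$ is a tail if and only if $g_I \nmid v$.
   Context: $m = p_1^{e_1}\cdots p_r^{e_r}$ with distinct primes, $e_i\ge1$. For $I\subseteq R$: $g_I = \prod_{i\in I} p_i^{e_i}$ ($g_\emptyset = 1$), and $d_I$ is the idempotent with $d_I\equiv 0\pmod{p_i^{e_i}}$ for $i\in I$, $d_I\equiv1\pmod{p_j^{e_j}}$ for $j\notin I$. Since $g_I \mid m$, divisibility of $v$ by $g_I$ is well defined for $v\in\mathbb{Z}/m\mathbb{Z}$. The sequential power graph of $\mathbb{Z}/m\mathbb{Z}$ is the directed graph on $\mathbb{Z}/m\mathbb{Z}$ with an edge $(b,c)$ iff $b\equiv a^i$, $c\equiv a^{i+1}\pmod m$ for some $a$ and $i\in\mathbb{N}$; connected components are with respect to undirected paths. An element $v$ is a tail if it lies in the tail (the non-periodic initial part $a, a^2, \dots, a^{j-1}$, where $a^j$ is the first power starting the cycle) of some orbit; equivalently, $v^{k+1}\not\equiv v \pmod m$ for all $k\ge1$. -}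

module Defs where

open import Data.Nat using (ℕ; zero; suc; _+_; _*_; _^_; _≤_; _<_; NonZero)
open import Data.Nat.DivMod using (_%_)
open import Data.Fin using (Fin)
import Data.Fin as F
open import Data.Fin.Subset using (Subset; _∈_; _∉_)
open import Data.Bool using (Bool; true; false; if_then_else_)
open import Data.Vec using (lookup)
open import Data.Product using (Σ; ∃; _×_)
open import Relation.Binary.PropositionalEquality using (_≡_; _≢_)
open import Relation.Binary.Construct.Closure.Equivalence using (EqClosure)

∏ : ∀ {r} → (Fin r → ℕ) → ℕ
∏ {zero}  f = 1
∏ {suc r} f = f F.zero * ∏ (λ i → f (F.suc i))

gI : ∀ {r} → (p e : Fin r → ℕ) → Subset r → ℕ
gI p e I = ∏ (λ i → if lookup I i then p i ^ e i else 1)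

-- Edge of the sequential power graph of ℤ/mℤ, residues represented by 0 … m-1:
-- (b,c) is an edge iff b ≡ a^i, c ≡ a^(i+1) (mod m) for some a and some i ≥ 1.
SPEdge : (m : ℕ) → .{{NonZero m}} → ℕ → ℕ → Set
SPEdge m b c = b < m × c < m ×
  ∃ λ a → ∃ λ i → 1 ≤ i × b ≡ (a ^ i) % m × c ≡ (a ^ suc i) % m

Connected : (m : ℕ) → .{{NonZero m}} → ℕ → ℕ → Set
Connected m = EqClosure (SPEdge m)

-- v is a tail: v lies in the tail of the orbit a, a^2, … of some a, i.e.
-- v ≡ a^i with i ≥ 1 and a^i does not recur (a^(i+t) ≢ a^i for every t ≥ 1),
-- which is exactly i < j for j the index of the first power starting the cycle.
IsTail : (m : ℕ) → .{{NonZero m}} → ℕ → Set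
IsTail m v = ∃ λ a → ∃ λ i → 1 ≤ i × v ≡ (a ^ i) % m ×
  (∀ t → 1 ≤ t → (a ^ (i + t)) % m ≢ (a ^ i) % m)

module Submission where

-- Let m = ∏ qⱼ with qⱼ = pⱼ^eⱼ.  The proof has three ingredients.
--
-- 1. Prime support is a component invariant: for a prime p ∣ m and i ≥ 1,
--    p ∣ (aⁱ mod m) ⇔ p ∣ a, so both ends of an edge (aⁱ, aⁱ⁺¹) have the same
--    prime divisors among those of m.  The idempotent d_I is divisible by pⱼ
--    exactly for j ∈ I, hence so is every v in its component.
-- 2. If some qⱼ (j ∈ I) does not divide v although pⱼ does, then v is a tail of
--    its own orbit: v^(1+t) ≡ v would give v ≡ v^(1+eⱼt), which qⱼ divides.
-- 3. Conversely, if g_I ∣ v = aⁱ mod m, then every qⱼ divides aⁱ(aᵗ - 1), where t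
--    is the eventual period of the powers of a: for j ∈ I because qⱼ ∣ aⁱ, for
--    j ∉ I because pⱼ ∤ a and qⱼ ∣ a^i₀(aᵗ - 1).  The prime powers are pairwise
--    coprime, so m ∣ aⁱ⁺ᵗ - aⁱ and v recurs, i.e. v is not a tail.

open import Defs
open import Data.Nat using (ℕ; zero; suc; nonTrivial⇒≢1; >-nonZero; _+_; _*_; _^_; _≤_; _<_; _∸_; NonZero; z≤n; s≤s)
open import Data.Nat.Properties
open import Data.Nat.Divisibility
open import Data.Nat.DivMod
open import Data.Nat.Primality using (Prime; euclidsLemma; prime⇒irreducible; prime⇒nonTrivial; prime⇒nonZero)
open import Data.Fin using (Fin; toℕ; fromℕ<) renaming (zero to fzero; suc to fsuc)
open import Data.Fin.Properties using (pigeonhole; toℕ-fromℕ<; ¬∀⟶∃¬) renaming (suc-injective to fsuc-injective)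
open import Data.Fin.Subset using (Subset; _∈_; _∉_)
open import Data.Fin.Subset.Properties using (_∈?_)
open import Data.Vec using (lookup)
open import Data.Vec.Properties using ([]=⇒lookup; lookup⇒[]=)
open import Data.Bool using (true; false; if_then_else_)
open import Data.Product using (_×_; ∃; ∃₂; _,_)
open import Data.Sum using (_⊎_; inj₁; inj₂)
open import Function.Definitions using (Injective)
open import Function.Bundles using (_⇔_; mk⇔; Equivalence)
import Function.Properties.Equivalence as ⇔
open import Relation.Nullary using (¬_; yes; no; contradiction)
open import Relation.Nullary.Decidable using (_→-dec_)
open import Relation.Binary.PropositionalEquality
open import Relation.Binary.Construct.Closure.ReflexiveTransitive using (ε; _◅_)
open import Relation.Binary.Construct.Closure.Symmetric using (fwd; bwd)

open Equivalence using (to; from)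

prime∤1 : ∀ {p} → Prime p → ¬ p ∣ 1
prime∤1 pp p∣1 = nonTrivial⇒≢1 {{prime⇒nonTrivial pp}} (∣1⇒≡1 p∣1)

∏-cong : ∀ {r} {f g : Fin r → ℕ} → (∀ i → f i ≡ g i) → ∏ f ≡ ∏ g
∏-cong {zero}  f≡g = refl
∏-cong {suc r} f≡g = cong₂ _*_ (f≡g fzero) (∏-cong (λ i → f≡g (fsuc i)))

factor∣∏ : ∀ {r} (f : Fin r → ℕ) j → f j ∣ ∏ f
factor∣∏ f fzero    = m∣m*n _
factor∣∏ f (fsuc j) = ∣n⇒∣m*n (f fzero) (factor∣∏ (λ i → f (fsuc i)) j)

prime∤∏ : ∀ {r p} {f : Fin r → ℕ} → Prime p → (∀ i → ¬ p ∣ f i) → ¬ p ∣ ∏ f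
prime∤∏ {zero}  pp p∤f = prime∤1 pp
prime∤∏ {suc r} {f = f} pp p∤f p∣∏ with euclidsLemma (f fzero) _ pp p∣∏
... | inj₁ p∣f₀    = p∤f fzero p∣f₀
... | inj₂ p∣rest = prime∤∏ pp (λ i → p∤f (fsuc i)) p∣rest

prime∣^⇒∣ : ∀ {p} x n → Prime p → p ∣ x ^ n → p ∣ x
prime∣^⇒∣ x zero    pp p∣1 = contradiction p∣1 (prime∤1 pp)
prime∣^⇒∣ x (suc n) pp p∣xⁿ⁺¹ with euclidsLemma x (x ^ n) pp p∣xⁿ⁺¹
... | inj₁ p∣x  = p∣x
... | inj₂ p∣xⁿ = prime∣^⇒∣ x n pp p∣xⁿ

prime∣prime⇒≡ : ∀ {p q} → Prime p → Prime q → p ∣ q → p ≡ q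
prime∣prime⇒≡ pp pq p∣q with prime⇒irreducible pq p∣q
... | inj₁ p≡1 = contradiction p≡1 (nonTrivial⇒≢1 {{prime⇒nonTrivial pp}})
... | inj₂ p≡q = p≡q

p∣p^e : ∀ p {e} → 1 ≤ e → p ∣ p ^ e
p∣p^e p {suc e} _ = m∣m*n (p ^ e)

^-monoˡ-∣ : ∀ {a b} n → a ∣ b → a ^ n ∣ b ^ n
^-monoˡ-∣ zero    a∣b = ∣-refl
^-monoˡ-∣ (suc n) a∣b = *-pres-∣ a∣b (^-monoˡ-∣ n a∣b)

^-monoʳ-∣ : ∀ x {k n} → k ≤ n → x ^ k ∣ x ^ n
^-monoʳ-∣ x {k} {n} k≤n =
  subst (x ^ k ∣_) (trans (sym (^-distribˡ-+-* x k (n ∸ k))) (cong (x ^_) (m+[n∸m]≡n k≤n))) (m∣m*n _)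

prime^-cancel : ∀ {p a} e {b} → Prime p → ¬ p ∣ a → p ^ e ∣ a * b → p ^ e ∣ b
prime^-cancel zero {b} pp p∤a _ = 1∣ b
prime^-cancel {p} {a} (suc e) {b} pp p∤a pᵉ⁺¹∣ab
  with euclidsLemma a b pp (∣-trans (m∣m*n (p ^ e)) pᵉ⁺¹∣ab)
... | inj₁ p∣a = contradiction p∣a p∤a
... | inj₂ (divides c refl) =
  subst (p * p ^ e ∣_) (*-comm p c) (*-monoʳ-∣ p (prime^-cancel e pp p∤a pᵉ∣ac))
  where
  instance _ = prime⇒nonZero pp
  regroup : a * (c * p) ≡ p * (a * c)
  regroup = trans (sym (*-assoc a c p)) (*-comm (a * c) p)
  pᵉ∣ac : p ^ e ∣ a * c
  pᵉ∣ac = *-cancelˡ-∣ p (subst (p * p ^ e ∣_) regroup pᵉ⁺¹∣ab)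

prime^-*-∣ : ∀ {p e x y} → Prime p → p ^ e ∣ x → y ∣ x → ¬ p ∣ y → p ^ e * y ∣ x
prime^-*-∣ {p} {e} {y = y} pp pᵉ∣x (divides z refl) p∤y =
  *-monoˡ-∣ y (prime^-cancel e pp p∤y (subst (p ^ e ∣_) (*-comm z y) pᵉ∣x))

prime-powers-∏-∣ : ∀ {r x} (p k : Fin r → ℕ) → (∀ i → Prime (p i)) → Injective _≡_ _≡_ p →
  (∀ i → p i ^ k i ∣ x) → ∏ (λ i → p i ^ k i) ∣ x
prime-powers-∏-∣ {zero}  {x} p k pp p-inj divs = 1∣ x
prime-powers-∏-∣ {suc r} p k pp p-inj divs =
  prime^-*-∣ {e = k fzero} (pp fzero) (divs fzero)
    (prime-powers-∏-∣ (λ i → p (fsuc i)) (λ i → k (fsuc i)) (λ i → pp (fsuc i))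
      (λ eq → fsuc-injective (p-inj eq)) (λ i → divs (fsuc i)))
    (prime∤∏ (pp fzero) p₀∤later)
  where
  p₀∤later : ∀ i → ¬ p fzero ∣ p (fsuc i) ^ k (fsuc i)
  p₀∤later i p₀∣ with p-inj (prime∣prime⇒≡ (pp fzero) (pp (fsuc i))
                              (prime∣^⇒∣ _ (k (fsuc i)) (pp fzero) p₀∣))
  ... | ()

module Modular {m : ℕ} .{{_ : NonZero m}} where

  %≡%⇒∣∸ : ∀ x y → x % m ≡ y % m → m ∣ x ∸ y
  %≡%⇒∣∸ x y x≡y = divides (x / m ∸ y / m) (begin
    x ∸ y                                       ≡⟨ cong₂ _∸_ (m≡m%n+[m/n]*n x m) (m≡m%n+[m/n]*n y m) ⟩
    (x % m + x / m * m) ∸ (y % m + y / m * m)   ≡⟨ cong (λ z → (x % m + x / m * m) ∸ (z + y / m * m)) (sym x≡y) ⟩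
    (x % m + x / m * m) ∸ (x % m + y / m * m)   ≡⟨ [m+n]∸[m+o]≡n∸o (x % m) _ _ ⟩
    x / m * m ∸ y / m * m                       ≡⟨ sym (*-distribʳ-∸ m (x / m) (y / m)) ⟩
    (x / m ∸ y / m) * m                         ∎)
    where open ≡-Reasoning

  ∣∸⇒%≡% : ∀ x y → y ≤ x → m ∣ x ∸ y → x % m ≡ y % m
  ∣∸⇒%≡% x y y≤x m∣x∸y = trans (cong (_% m) (sym (m+[n∸m]≡n y≤x))) (%-remove-+ʳ y m∣x∸y)

  ∣%⇔∣ : ∀ {q} x → q ∣ m → q ∣ x % m ⇔ q ∣ x
  ∣%⇔∣ x q∣m = mk⇔ (∣n∣m%n⇒∣m q∣m) (λ q∣x → %-presˡ-∣ q∣x q∣m)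

  iterate-recurrence : ∀ v t → v ^ (1 + t) % m ≡ v % m → ∀ n → v ^ (1 + n * t) % m ≡ v % m
  iterate-recurrence v t rec zero = cong (_% m) (*-identityʳ v)
  iterate-recurrence v t rec (suc n) = begin
    v ^ (1 + (t + n * t)) % m                    ≡⟨ cong (λ z → v ^ suc z % m) (+-comm t (n * t)) ⟩
    v ^ ((1 + n * t) + t) % m                    ≡⟨ cong (_% m) (^-distribˡ-+-* v (1 + n * t) t) ⟩
    (v ^ (1 + n * t) * v ^ t) % m                ≡⟨ %-distribˡ-* _ _ m ⟩
    (v ^ (1 + n * t) % m * (v ^ t % m)) % m      ≡⟨ cong (λ z → (z * (v ^ t % m)) % m) (iterate-recurrence v t rec n) ⟩
    (v % m * (v ^ t % m)) % m                    ≡⟨ sym (%-distribˡ-* v (v ^ t) m) ⟩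
    (v * v ^ t) % m                              ≡⟨ rec ⟩
    v % m                                        ∎
    where open ≡-Reasoning

  eventually-periodic : ∀ a → ∃₂ λ i t → 1 ≤ t × a ^ (i + t) % m ≡ a ^ i % m
  eventually-periodic a with pigeonhole (n<1+n m) (λ k → fromℕ< (m%n<n (a ^ toℕ k) m))
  ... | k₁ , k₂ , k₁<k₂ , same =
    toℕ k₁ , toℕ k₂ ∸ toℕ k₁ , m<n⇒0<n∸m k₁<k₂ ,
    trans (cong (λ z → a ^ z % m) (m+[n∸m]≡n (<⇒≤ k₁<k₂)))
      (trans (sym (toℕ-fromℕ< _)) (trans (cong toℕ (sym same)) (toℕ-fromℕ< _)))

open Modular

aⁱ⁺ᵗ∸aⁱ : ∀ a i t → a ^ (i + t) ∸ a ^ i ≡ a ^ i * (a ^ t ∸ 1)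
aⁱ⁺ᵗ∸aⁱ a i t = trans (cong₂ _∸_ (^-distribˡ-+-* a i t) (sym (*-identityʳ (a ^ i))))
                      (sym (*-distribˡ-∸ (a ^ i) (a ^ t) 1))

prime∣power%⇔ : ∀ {m p} .{{_ : NonZero m}} → Prime p → p ∣ m → ∀ a {i} → 1 ≤ i →
  p ∣ a ^ i % m ⇔ p ∣ a
prime∣power%⇔ pp p∣m a {suc i} _ =
  ⇔.trans (∣%⇔∣ (a ^ suc i) p∣m) (mk⇔ (prime∣^⇒∣ a (suc i) pp) (∣m⇒∣m*n (a ^ i)))

edge-preserves-∣ : ∀ {m p b c} .{{_ : NonZero m}} → Prime p → p ∣ m → SPEdge m b c → p ∣ b ⇔ p ∣ c
edge-preserves-∣ pp p∣m (_ , _ , a , i , i≥1 , refl , refl) =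
  ⇔.trans (prime∣power%⇔ pp p∣m a i≥1) (⇔.sym (prime∣power%⇔ pp p∣m a {suc i} (s≤s z≤n)))

connected-preserves-∣ : ∀ {m p x y} .{{_ : NonZero m}} → Prime p → p ∣ m → Connected m x y → p ∣ x ⇔ p ∣ y
connected-preserves-∣ pp p∣m ε             = ⇔.refl
connected-preserves-∣ pp p∣m (fwd edge ◅ path) =
  ⇔.trans (edge-preserves-∣ pp p∣m edge) (connected-preserves-∣ pp p∣m path)
connected-preserves-∣ pp p∣m (bwd edge ◅ path) =
  ⇔.trans (⇔.sym (edge-preserves-∣ pp p∣m edge)) (connected-preserves-∣ pp p∣m path)

-- Ingredient 2: a residue divisible by p but not by pᵉ, where pᵉ ∣ m, is a tail,
-- already of its own orbit v, v², … (p need not even be prime here).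
non-full-power⇒tail : ∀ {m p e v} .{{_ : NonZero m}} → p ^ e ∣ m → v < m →
  p ∣ v → ¬ p ^ e ∣ v → IsTail m v
non-full-power⇒tail {m} {p} {e} {v} pᵉ∣m v<m p∣v pᵉ∤v =
  v , 1 , s≤s z≤n , sym v¹%m≡v , never-recurs
  where
  v¹%m≡v : v ^ 1 % m ≡ v
  v¹%m≡v = trans (cong (_% m) (*-identityʳ v)) (m<n⇒m%n≡m v<m)
  never-recurs : ∀ t → 1 ≤ t → v ^ (1 + t) % m ≢ v ^ 1 % m
  never-recurs t t≥1 rec = pᵉ∤v (subst (p ^ e ∣_) (trans back-to-v (m<n⇒m%n≡m v<m)) pᵉ∣power)
    where
    back-to-v : v ^ (1 + e * t) % m ≡ v % m
    back-to-v = iterate-recurrence v t (trans rec (cong (_% m) (*-identityʳ v))) e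
    e≤exponent : e ≤ 1 + e * t
    e≤exponent = ≤-trans (m≤m*n e t {{>-nonZero t≥1}}) (n≤1+n _)
    pᵉ∣power : p ^ e ∣ v ^ (1 + e * t) % m
    pᵉ∣power = from (∣%⇔∣ _ pᵉ∣m) (∣-trans (^-monoˡ-∣ e p∣v) (^-monoʳ-∣ v e≤exponent))

module Factorisation {r : ℕ} (p e : Fin r → ℕ) (primes : ∀ j → Prime (p j))
  (distinct : Injective _≡_ _≡_ p) (e≥1 : ∀ j → 1 ≤ e j)
  (m : ℕ) .{{_ : NonZero m}} (m≡∏ : m ≡ ∏ (λ j → p j ^ e j)) where

  q∣m : ∀ j → p j ^ e j ∣ m
  q∣m j = subst (p j ^ e j ∣_) (sym m≡∏) (factor∣∏ (λ j → p j ^ e j) j)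

  p∣m : ∀ j → p j ∣ m
  p∣m j = ∣-trans (p∣p^e (p j) (e≥1 j)) (q∣m j)

  all-q∣⇒m∣ : ∀ {x} → (∀ j → p j ^ e j ∣ x) → m ∣ x
  all-q∣⇒m∣ divs = subst (_∣ _) (sym m≡∏) (prime-powers-∏-∣ p e primes distinct divs)

  power-recurs : ∀ a {i} → 1 ≤ i → (∀ j → ¬ p j ∣ a ⊎ p j ^ e j ∣ a ^ i % m) →
    ∃ λ t → 1 ≤ t × a ^ (i + t) % m ≡ a ^ i % m
  power-recurs zero {suc i} _ _ = 1 , s≤s z≤n , refl
  power-recurs a@(suc _) {i} _ status with eventually-periodic a
  ... | i₀ , t , t≥1 , period = t , t≥1 , ∣∸⇒%≡% _ _ (^-monoʳ-≤ a (m≤m+n i t)) m∣aⁱ⁺ᵗ∸aⁱ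
    where
    qⱼ∣aⁱ[aᵗ∸1] : ∀ j → p j ^ e j ∣ a ^ i * (a ^ t ∸ 1)
    qⱼ∣aⁱ[aᵗ∸1] j with status j
    ... | inj₂ qⱼ∣aⁱ%m = ∣m⇒∣m*n _ (to (∣%⇔∣ _ (q∣m j)) qⱼ∣aⁱ%m)
    ... | inj₁ pⱼ∤a    = ∣n⇒∣m*n (a ^ i) (prime^-cancel (e j) (primes j) pⱼ∤aⁱ⁰ qⱼ∣aⁱ⁰[aᵗ∸1])
      where
      pⱼ∤aⁱ⁰ : ¬ p j ∣ a ^ i₀
      pⱼ∤aⁱ⁰ pⱼ∣aⁱ⁰ = pⱼ∤a (prime∣^⇒∣ a i₀ (primes j) pⱼ∣aⁱ⁰)
      qⱼ∣aⁱ⁰[aᵗ∸1] : p j ^ e j ∣ a ^ i₀ * (a ^ t ∸ 1)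
      qⱼ∣aⁱ⁰[aᵗ∸1] = subst (p j ^ e j ∣_) (aⁱ⁺ᵗ∸aⁱ a i₀ t) (∣-trans (q∣m j) (%≡%⇒∣∸ _ _ period))
    m∣aⁱ⁺ᵗ∸aⁱ : m ∣ a ^ (i + t) ∸ a ^ i
    m∣aⁱ⁺ᵗ∸aⁱ = subst (m ∣_) (sym (aⁱ⁺ᵗ∸aⁱ a i t)) (all-q∣⇒m∣ qⱼ∣aⁱ[aᵗ∸1])

  q∣gI : ∀ I j → j ∈ I → p j ^ e j ∣ gI p e I
  q∣gI I j j∈I = subst (λ b → (if b then p j ^ e j else 1) ∣ gI p e I) ([]=⇒lookup j∈I)
                       (factor∣∏ (λ i → if lookup I i then p i ^ e i else 1) j)

  gI∣ : ∀ I {x} → (∀ j → j ∈ I → p j ^ e j ∣ x) → gI p e I ∣ x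
  gI∣ I {x} divs = subst (_∣ x) (sym (∏-cong selected-power))
                     (prime-powers-∏-∣ p exponent primes distinct selected-∣)
    where
    exponent : Fin r → ℕ
    exponent j = if lookup I j then e j else 0
    selected-power : ∀ j → (if lookup I j then p j ^ e j else 1) ≡ p j ^ exponent j
    selected-power j with lookup I j
    ... | true  = refl
    ... | false = refl
    selected-∣ : ∀ j → p j ^ exponent j ∣ x
    selected-∣ j with lookup I j in j-selected
    ... | true  = divs j (lookup⇒[]= j I j-selected)
    ... | false = 1∣ x

  gI∤⇒witness : ∀ I {x} → ¬ gI p e I ∣ x → ∃ λ j → j ∈ I × ¬ p j ^ e j ∣ x
  gI∤⇒witness I {x} gI∤x
    with ¬∀⟶∃¬ r (λ j → j ∈ I → p j ^ e j ∣ x) (λ j → (j ∈? I) →-dec (p j ^ e j ∣? x))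
               (λ divs → gI∤x (gI∣ I divs))
  ... | j , fails with j ∈? I
  ...   | yes j∈I = j , j∈I , λ qⱼ∣x → fails (λ _ → qⱼ∣x)
  ...   | no  j∉I = contradiction (λ j∈I → contradiction j∈I j∉I) fails

  idempotent-support : ∀ I {d} → (∀ i → i ∈ I → p i ^ e i ∣ d) →
    (∀ j → j ∉ I → ∃ λ k → d ≡ 1 + k * p j ^ e j) → ∀ j → p j ∣ d ⇔ j ∈ I
  idempotent-support I {d} dI dJ j = mk⇔ only-I (λ j∈I → ∣-trans (p∣p^e (p j) (e≥1 j)) (dI j j∈I))
    where
    only-I : p j ∣ d → j ∈ I
    only-I pⱼ∣d with j ∈? I
    ... | yes j∈I = j∈I
    ... | no  j∉I with dJ j j∉I
    ...   | k , refl = contradiction pⱼ∣1 (prime∤1 (primes j))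
      where
      pⱼ∣1 : p j ∣ 1
      pⱼ∣1 = ∣m+n∣m⇒∣n (subst (p j ∣_) (+-comm 1 _) pⱼ∣d) (∣n⇒∣m*n k (p∣p^e (p j) (e≥1 j)))

mainTheorem8 : (r : ℕ) (p e : Fin r → ℕ) →
    (∀ i → Prime (p i)) → Injective _≡_ _≡_ p → (∀ i → 1 ≤ e i) →
    (m : ℕ) → .{{_ : NonZero m}} → m ≡ ∏ (λ i → p i ^ e i) →
    (I : Subset r) →
    (d : ℕ) → d < m →
    (∀ i → i ∈ I → (p i ^ e i) ∣ d) →
    (∀ j → j ∉ I → ∃ λ k → d ≡ 1 + k * (p j ^ e j)) →
    (v : ℕ) → v < m → Connected m d v →
    (IsTail m v ⇔ (¬ (gI p e I ∣ v)))
mainTheorem8 r p e primes distinct e≥1 m m≡∏ I d _ dI dJ v v<m d~v = mk⇔ tail⇒gI∤ gI∤⇒tail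
  where
  open Factorisation p e primes distinct e≥1 m m≡∏

  support : ∀ j → p j ∣ v ⇔ j ∈ I
  support j = ⇔.trans (⇔.sym (connected-preserves-∣ (primes j) (p∣m j) d~v)) (idempotent-support I dI dJ j)

  gI∤⇒tail : ¬ gI p e I ∣ v → IsTail m v
  gI∤⇒tail gI∤v with gI∤⇒witness I gI∤v
  ... | j , j∈I , qⱼ∤v = non-full-power⇒tail {e = e j} (q∣m j) v<m (from (support j) j∈I) qⱼ∤v

  tail⇒gI∤ : IsTail m v → ¬ gI p e I ∣ v
  tail⇒gI∤ (a , i , i≥1 , v≡aⁱ , never-recurs) gI∣v =
    let t , t≥1 , recurs = power-recurs a i≥1 status in never-recurs t t≥1 recurs
    where
    status : ∀ j → ¬ p j ∣ a ⊎ p j ^ e j ∣ a ^ i % m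
    status j with j ∈? I
    ... | yes j∈I = inj₂ (subst (p j ^ e j ∣_) v≡aⁱ (∣-trans (q∣gI I j j∈I) gI∣v))
    ... | no  j∉I = inj₁ λ pⱼ∣a →
      j∉I (to (support j) (subst (p j ∣_) (sym v≡aⁱ) (from (prime∣power%⇔ (primes j) (p∣m j) a i≥1) pⱼ∣a)))
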